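{- Let $k\ge 4$ be an integer, $m=2^{k+1}$, $\nu$ an integer with $2\le\nu\le k+1$, $\beta$ an integer with $|\beta|<2^{2^{\nu-1}}$, and $\gamma=\beta 2^{ -2^{\nu}}$. Put $r=m2^{ -\nu+2}$, $k_1=\log_2 r$ and $r_1=\lceil r/k_1\rceil$. For $t=1,\dots,k_1$ let $\sigma_t=\sum_{j=0}^{r_1-1}\frac{\gamma^j}{\prod_{l=1}^{j}((t-1)r_1+l)}$, and for $t=2,\dots,k_1$ let $\tau_t=\frac{\gamma^{r_1}}{\prod_{l=1}^{r_1}((t-2)r_1+l)}$. Let $m_1\ge m$ be an integer and let $\sigma_t^*,\tau_t^*$ be real numbers with $|\sigma_t^*-\sigma_t|\le 2^{ -m_1}$, $|\tau_t^*-\tau_t|\le 2^{ -m_1}$. Define $h_1=\sigma_{k_1}^*$ and, for $i=2,\dots,k_1$, $\widehat h_i=\sigma^*_{k_1-i+1}+\tau^*_{k_1-i+2}h_{i-1}$ and $h_i=T_{m_1}(\widehat h_i)$, where $T_{m_1}(u)=\operatorname{sign}(u)\lfloor |u|2^{m_1}\rfloor 2^{ -m_1}$ discards all binary digits of $u$ after the $m_1$-th digit after the binary point. Define also the exact values $H_1=\sigma_{k_1}$ and $H_i=\sigma_{k_1-i+1}+\tau_{k_1-i+2}H_{i-1}$ for $i=2,\dots,k_1$. Then $|h_{k_1}-H_{k_1}|<2^{ -m_1+k_1}$. -}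

module Defs where

open import Level using (0ℓ)
open import Data.Nat as ℕ using (ℕ; zero; suc; _∸_; _^_)
open import Data.Nat.DivMod using (_/_)
open import Data.Integer as ℤ using (ℤ; +_; -[1+_])
open import Data.Sum using (_⊎_)
open import Relation.Binary.PropositionalEquality using (_≡_; _≢_)
open import Relation.Binary.Structures using (IsStrictTotalOrder)
open import Relation.Binary.Definitions using (tri<; tri≈; tri>)
open import Algebra.Structures using (IsCommutativeRing)

-- ceiling division ⌈ a / b ⌉ (b ≥ 1; junk value 0 for b = 0)
⌈_/ₙ_⌉ : ℕ → ℕ → ℕ
⌈ a /ₙ zero ⌉  = 0
⌈ a /ₙ suc b ⌉ = (a ℕ.+ b) / suc b

prodFrom : ℕ → ℕ → ℕ
prodFrom a zero    = 1
prodFrom a (suc j) = prodFrom a j ℕ.* (a ℕ.+ suc j)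

module _ {A : Set} (0a 1a : A) (_+a_ : A → A → A) (-a_ : A → A) where
  embℕ : ℕ → A
  embℕ zero    = 0a
  embℕ (suc n) = 1a +a embℕ n

  embℤ : ℤ → A
  embℤ (+ n)      = embℕ n
  embℤ -[1+ n ]   = -a (embℕ (suc n))

-- The real numbers, axiomatised as an Archimedean ordered field with
-- a floor function (every such field embeds into ℝ preserving
-- +, *, inverses, order and floor; ℝ itself is a model).

record RealField : Set₁ where
  infixl 6 _+_
  infixl 7 _*_
  infix  8 -_
  infix  4 _<_
  field
    Carrier : Set
    _+_ _*_ : Carrier → Carrier → Carrier
    -_      : Carrier → Carrier
    0# 1#   : Carrier
    _⁻¹     : Carrier → Carrier           -- total; value at 0 irrelevant
    _<_     : Carrier → Carrier → Set
    isCommutativeRing : IsCommutativeRing _≡_ _+_ _*_ -_ 0# 1#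
    ⁻¹-inverse        : ∀ x → x ≢ 0# → x * (x ⁻¹) ≡ 1#
    isStrictTotalOrder : IsStrictTotalOrder _≡_ _<_
    0<1               : 0# < 1#
    +-mono-<          : ∀ {x y} z → x < y → x + z < y + z
    *-pos             : ∀ {x y} → 0# < x → 0# < y → 0# < x * y
    ⌊_⌋               : Carrier → ℤ
    ⌊⌋-lower          : ∀ x → embℤ 0# 1# _+_ -_ ⌊ x ⌋ < x ⊎ embℤ 0# 1# _+_ -_ ⌊ x ⌋ ≡ x
    ⌊⌋-upper          : ∀ x → x < embℤ 0# 1# _+_ -_ ⌊ x ⌋ + 1#

  infix 4 _≤_
  _≤_ : Carrier → Carrier → Set
  x ≤ y = x < y ⊎ x ≡ y

  _−_ : Carrier → Carrier → Carrier
  x − y = x + (- y)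

  fromℕ : ℕ → Carrier
  fromℕ = embℕ 0# 1# _+_ -_

  fromℤ : ℤ → Carrier
  fromℤ = embℤ 0# 1# _+_ -_

  _^ᶠ_ : Carrier → ℕ → Carrier
  x ^ᶠ zero  = 1#
  x ^ᶠ suc n = x * (x ^ᶠ n)

  ∣_∣ : Carrier → Carrier
  ∣ x ∣ with IsStrictTotalOrder.compare isStrictTotalOrder x 0#
  ... | tri< _ _ _ = - x
  ... | tri≈ _ _ _ = x
  ... | tri> _ _ _ = x

  T : ℕ → Carrier → Carrier
  T m u with IsStrictTotalOrder.compare isStrictTotalOrder u 0#
  ... | tri< _ _ _ = - (fromℤ ⌊ (- u) * fromℕ (2 ^ m) ⌋ * (fromℕ (2 ^ m) ⁻¹))
  ... | tri≈ _ _ _ = 0#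
  ... | tri> _ _ _ = fromℤ ⌊ u * fromℕ (2 ^ m) ⌋ * (fromℕ (2 ^ m) ⁻¹)

  sumTo : ℕ → (ℕ → Carrier) → Carrier
  sumTo zero    f = 0#
  sumTo (suc n) f = sumTo n f + f n

module Setup (R : RealField) (k ν : ℕ) (β : ℤ) where
  open RealField R

  m : ℕ
  m = 2 ^ (k ℕ.+ 1)

  -- r = m 2^(-ν+2) = 2^(k+3-ν)   (using ν ≤ k+1)
  r : ℕ
  r = 2 ^ ((k ℕ.+ 3) ∸ ν)

  -- k₁ = log₂ r
  k₁ : ℕ
  k₁ = (k ℕ.+ 3) ∸ ν

  r₁ : ℕ
  r₁ = ⌈ r /ₙ k₁ ⌉

  γ : Carrier
  γ = fromℤ β * (fromℕ (2 ^ (2 ^ ν)) ⁻¹)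

  σ : ℕ → Carrier
  σ t = sumTo r₁ (λ j → (γ ^ᶠ j) * (fromℕ (prodFrom ((t ∸ 1) ℕ.* r₁) j) ⁻¹))

  τ : ℕ → Carrier
  τ t = (γ ^ᶠ r₁) * (fromℕ (prodFrom ((t ∸ 2) ℕ.* r₁) r₁) ⁻¹)

  -- exact values: H 1 = σ_{k₁},  H i = σ_{k₁-i+1} + τ_{k₁-i+2} H_{i-1}
  -- (H 0 is an unused junk value)
  H : ℕ → Carrier
  H zero                = 0#
  H (suc zero)          = σ k₁
  H (suc (suc n))       = σ (k₁ ∸ suc n) + τ (k₁ ∸ n) * H (suc n)

  h : ℕ → (ℕ → Carrier) → (ℕ → Carrier) → ℕ → Carrier
  h m₁ σ* τ* zero          = 0#
  h m₁ σ* τ* (suc zero)    = σ* k₁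
  h m₁ σ* τ* (suc (suc n)) = T m₁ (σ* (k₁ ∸ suc n) + τ* (k₁ ∸ n) * h m₁ σ* τ* (suc n))

-- The computed values are h_1 = σ*_{k₁}, h_i = T_{m₁}(σ* + τ* h_{i-1}), with
-- |σ* - σ|, |τ* - τ| ≤ ε = 2^-m₁.  One step turns an incoming error e into at
-- most  ε (truncation) + ε (error of σ*) + |τ*| e + ε |H|  (step-error).  The
-- a-priori bounds |γ| ≤ 1/4, hence 2|σ_t| ≤ 3 (a geometric series), 4|τ_t| ≤ 1,
-- 2|τ*_t| ≤ 1 and 2|H_i| ≤ 4, make this at most 4ε + e/2 (and < 4ε in the first
-- step, where 2|H_1| ≤ 3 and e ≤ ε).  By induction the error after i ≥ 2
-- steps is below 2^i ε, in particular |h_{k₁} - H_{k₁}| < 2^{k₁} ε.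

module Submission where

open import Defs
open import Level using (0ℓ)
open import Data.Nat as ℕ using (ℕ; zero; suc; _^_; _∸_)
import Data.Nat.Properties as ℕₚ
open import Data.Integer as ℤ using (ℤ)
open import Data.Sum using (_⊎_; inj₁; inj₂)
open import Data.Product using (_×_; _,_; proj₁; proj₂)
open import Data.Empty using (⊥-elim)
open import Relation.Nullary using (¬_)
open import Relation.Binary.PropositionalEquality
  using (_≡_; _≢_; refl; sym; trans; cong; cong₂; subst; subst₂; module ≡-Reasoning)
open import Relation.Binary.Bundles using (StrictPartialOrder)
open import Relation.Binary.Structures using (IsStrictTotalOrder)
open import Relation.Binary.Definitions using (tri<; tri≈; tri>)
import Relation.Binary.Construct.StrictToNonStrict as NonStrict
import Relation.Binary.Reasoning.StrictPartialOrder as StrictReasoning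
open import Algebra.Bundles using (CommutativeRing)
open import Algebra.Structures using (IsCommutativeRing)
import Algebra.Properties.Ring as RingProperties
import Algebra.Properties.CommutativeSemigroup as CommSemigroupProperties

module NatFacts where
  open import Data.Nat using (_+_; _*_; _≤_; _<_; z≤n; s≤s)
  open import Data.Nat.DivMod using (m≥n⇒m/n>0)

  k+3∸ν≥2 : ∀ k ν → ν ≤ k + 1 → 2 ≤ (k + 3) ∸ ν
  k+3∸ν≥2 k ν ν≤k+1 = ℕₚ.m+n≤o⇒m≤o∸n 2
    (subst (2 + ν ≤_) (trans (ℕₚ.+-comm 2 (k + 1)) (ℕₚ.+-assoc k 1 2)) (ℕₚ.+-monoʳ-≤ 2 ν≤k+1))

  ⌈/⌉-pos : ∀ a b → 1 ≤ a → 1 ≤ b → 1 ≤ ⌈ a /ₙ b ⌉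
  ⌈/⌉-pos a (suc b) a≥1 _ = m≥n⇒m/n>0 {a + b} {suc b} (ℕₚ.+-monoˡ-≤ b a≥1)

  prodFrom≥1 : ∀ a j → 1 ≤ prodFrom a j
  prodFrom≥1 a zero    = ℕₚ.≤-refl
  prodFrom≥1 a (suc j) = ℕₚ.*-mono-≤ (prodFrom≥1 a j) (subst (1 ≤_) (sym (ℕₚ.+-suc a j)) (s≤s z≤n))

  2≤2^suc : ∀ n → 2 ≤ 2 ^ suc n
  2≤2^suc n = ℕₚ.*-monoʳ-≤ 2 (ℕₚ.m^n>0 2 n)

  2^2^suc : ∀ w → 2 ^ (2 ^ suc w) ≡ 2 ^ (2 ^ w) * 2 ^ (2 ^ w)
  2^2^suc w = trans (ℕₚ.^-distribˡ-+-* 2 e (e + 0)) (cong (λ z → 2 ^ e * 2 ^ z) (ℕₚ.+-identityʳ e))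
    where
    e : ℕ
    e = 2 ^ w

  -- If b < 2^(2^(ν-1)) and ν ≥ 2 then 4b ≤ 2^(2^ν): with A = 2^(2^(ν-1)) ≥ 4
  -- we have 4b ≤ A·A = 2^(2^ν).
  4b≤2^2^ν : ∀ ν b → 2 ≤ ν → b < 2 ^ (2 ^ (ν ∸ 1)) → 4 * b ≤ 2 ^ (2 ^ ν)
  4b≤2^2^ν (suc zero) b (s≤s ()) _
  4b≤2^2^ν (suc (suc w)) b _ b<A = begin
    4 * b   ≤⟨ ℕₚ.*-mono-≤ 4≤A (ℕₚ.<⇒≤ b<A) ⟩
    A * A   ≡⟨ 2^2^suc (suc w) ⟨
    2 ^ (2 ^ suc (suc w)) ∎
    where
    open ℕₚ.≤-Reasoning
    A : ℕ
    A = 2 ^ (2 ^ suc w)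
    4≤A : 4 ≤ A
    4≤A = ℕₚ.^-monoʳ-≤ 2 (2≤2^suc w)

  2≤m₁ : ∀ k m₁ → 2 ^ (k + 1) ≤ m₁ → 2 ≤ m₁
  2≤m₁ k m₁ = ℕₚ.≤-trans (ℕₚ.^-monoʳ-≤ 2 (ℕₚ.m≤n+m 1 k))

  step-budget : ∀ n → 2 + (2 + (2 ^ (2 + n) + 4)) ≤ 2 * 2 ^ (3 + n)
  step-budget n = begin
    2 + (2 + (P + 4))  ≡⟨ cong (λ z → 2 + (2 + z)) (ℕₚ.+-comm P 4) ⟩
    8 + P              ≤⟨ ℕₚ.+-mono-≤ (ℕₚ.^-monoʳ-≤ 2 (ℕₚ.m≤m+n 3 n)) (ℕₚ.^-monoʳ-≤ 2 (ℕₚ.n≤1+n (2 + n))) ⟩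
    Q + Q              ≡⟨ cong (Q +_) (ℕₚ.+-identityʳ Q) ⟨
    2 * Q              ∎
    where
    open ℕₚ.≤-Reasoning
    P Q : ℕ
    P = 2 ^ (2 + n)
    Q = 2 ^ (3 + n)

open NatFacts

module OrderedField (R : RealField) where
  open RealField R
  open IsCommutativeRing isCommutativeRing
    using (+-assoc; +-comm; +-identityˡ; +-identityʳ; -‿inverseˡ; -‿inverseʳ;
           *-assoc; *-comm; *-identityˡ; *-identityʳ; distribˡ; distribʳ; zeroˡ; zeroʳ)
  open IsStrictTotalOrder isStrictTotalOrder using (compare; irrefl; <-resp-≈; isEquivalence)
    renaming (trans to <-trans; isStrictPartialOrder to <-isStrictPartialOrder)

  commutativeRing : CommutativeRing 0ℓ 0ℓ
  commutativeRing = record { isCommutativeRing = isCommutativeRing }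

  open RingProperties (CommutativeRing.ring commutativeRing) public
    using (-‿involutive; -‿+-comm; ⁻¹-anti-homo‿-; xyx⁻¹≈y; -‿distribˡ-*; -‿distribʳ-*; -0#≈0#;
           x[y-z]≈xy-xz; [y-z]x≈yx-zx)
  open CommSemigroupProperties (CommutativeRing.+-commutativeSemigroup commutativeRing) public
    using (interchange)
  open CommSemigroupProperties (CommutativeRing.*-commutativeSemigroup commutativeRing) public
    using (x∙yz≈y∙xz)

  strictPartialOrder : StrictPartialOrder 0ℓ 0ℓ 0ℓ
  strictPartialOrder = record { isStrictPartialOrder = <-isStrictPartialOrder }

  -- Inequality chains mixing _<_, _≤_ and _≡_ (RealField._≤_ is the
  -- reflexive closure of _<_, exactly the relation used by this module).
  module ≤-Reasoning = StrictReasoning strictPartialOrder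

  <-irrefl : ∀ {x} → ¬ (x < x)
  <-irrefl = irrefl refl

  ≤-trans : ∀ {x y z} → x ≤ y → y ≤ z → x ≤ z
  ≤-trans = NonStrict.trans _≡_ _<_ isEquivalence <-resp-≈ <-trans

  <-≤-trans : ∀ {x y z} → x < y → y ≤ z → x < z
  <-≤-trans = NonStrict.<-≤-trans _≡_ _<_ <-trans (proj₁ <-resp-≈)

  ≤-<-trans : ∀ {x y z} → x ≤ y → y < z → x < z
  ≤-<-trans = NonStrict.≤-<-trans _≡_ _<_ sym <-trans (proj₂ <-resp-≈)

  +-monoʳ-< : ∀ {x y} z → x < y → z + x < z + y
  +-monoʳ-< {x} {y} z p = subst₂ _<_ (+-comm x z) (+-comm y z) (+-mono-< z p)

  +-monoˡ-≤ : ∀ {x y} z → x ≤ y → x + z ≤ y + z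
  +-monoˡ-≤ z (inj₁ p)    = inj₁ (+-mono-< z p)
  +-monoˡ-≤ z (inj₂ refl) = inj₂ refl

  +-monoʳ-≤ : ∀ {x y} z → x ≤ y → z + x ≤ z + y
  +-monoʳ-≤ z (inj₁ p)    = inj₁ (+-monoʳ-< z p)
  +-monoʳ-≤ z (inj₂ refl) = inj₂ refl

  +-mono-≤ : ∀ {a b c d} → a ≤ b → c ≤ d → a + c ≤ b + d
  +-mono-≤ {b = b} {c} p q = ≤-trans (+-monoˡ-≤ c p) (+-monoʳ-≤ b q)

  +-mono-<-≤ : ∀ {a b c d} → a < b → c ≤ d → a + c < b + d
  +-mono-<-≤ {b = b} {c} p q = <-≤-trans (+-mono-< c p) (+-monoʳ-≤ b q)

  x≤x+y : ∀ {x y} → 0# ≤ y → x ≤ x + y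
  x≤x+y {x} {y} p = subst (_≤ x + y) (+-identityʳ x) (+-monoʳ-≤ x p)

  neg-anti-< : ∀ {x y} → x < y → - y < - x
  neg-anti-< {x} {y} p = subst₂ _<_ left right (+-mono-< (- x + - y) p)
    where
    open ≡-Reasoning
    left : x + (- x + - y) ≡ - y
    left = begin
      x + (- x + - y)   ≡⟨ +-assoc x (- x) (- y) ⟨
      (x + - x) + - y   ≡⟨ cong (_+ - y) (-‿inverseʳ x) ⟩
      0# + - y          ≡⟨ +-identityˡ (- y) ⟩
      - y               ∎
    right : y + (- x + - y) ≡ - x
    right = begin
      y + (- x + - y)   ≡⟨ cong (y +_) (+-comm (- x) (- y)) ⟩
      y + (- y + - x)   ≡⟨ +-assoc y (- y) (- x) ⟨
      (y + - y) + - x   ≡⟨ cong (_+ - x) (-‿inverseʳ y) ⟩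
      0# + - x          ≡⟨ +-identityˡ (- x) ⟩
      - x               ∎

  neg-anti-≤ : ∀ {x y} → x ≤ y → - y ≤ - x
  neg-anti-≤ (inj₁ p)    = inj₁ (neg-anti-< p)
  neg-anti-≤ (inj₂ refl) = inj₂ refl

  neg-nonneg : ∀ {x} → 0# ≤ x → - x ≤ 0#
  neg-nonneg p = subst (_ ≤_) -0#≈0# (neg-anti-≤ p)

  neg-neg : ∀ {x} → x < 0# → 0# < - x
  neg-neg p = subst (_< _) -0#≈0# (neg-anti-< p)

  *-monoʳ-< : ∀ {a b c} → 0# < c → a < b → c * a < c * b
  *-monoʳ-< {a} {b} {c} c>0 a<b = subst₂ _<_ (+-identityˡ (c * a)) cancel shifted
    where
    b-a>0 : 0# < b − a
    b-a>0 = subst (_< b − a) (-‿inverseʳ a) (+-mono-< (- a) a<b)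
    shifted : 0# + c * a < c * (b − a) + c * a
    shifted = +-mono-< (c * a) (*-pos c>0 b-a>0)
    cancel : c * (b − a) + c * a ≡ c * b
    cancel = begin
      c * (b − a) + c * a       ≡⟨ cong (_+ c * a) (x[y-z]≈xy-xz c b a) ⟩
      (c * b + - (c * a)) + c * a ≡⟨ +-assoc (c * b) (- (c * a)) (c * a) ⟩
      c * b + (- (c * a) + c * a) ≡⟨ cong (c * b +_) (-‿inverseˡ (c * a)) ⟩
      c * b + 0#                ≡⟨ +-identityʳ (c * b) ⟩
      c * b                     ∎
      where open ≡-Reasoning

  *-monoˡ-< : ∀ {a b c} → 0# < c → a < b → a * c < b * c
  *-monoˡ-< {a} {b} {c} c>0 p = subst₂ _<_ (*-comm c a) (*-comm c b) (*-monoʳ-< c>0 p)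

  *-monoʳ-≤ : ∀ {a b c} → 0# ≤ c → a ≤ b → c * a ≤ c * b
  *-monoʳ-≤ {a} {b} (inj₂ refl) _ = inj₂ (trans (zeroˡ a) (sym (zeroˡ b)))
  *-monoʳ-≤ (inj₁ c>0) (inj₁ a<b)  = inj₁ (*-monoʳ-< c>0 a<b)
  *-monoʳ-≤ (inj₁ c>0) (inj₂ refl) = inj₂ refl

  *-monoˡ-≤ : ∀ {a b c} → 0# ≤ c → a ≤ b → a * c ≤ b * c
  *-monoˡ-≤ {a} {b} {c} c≥0 p = subst₂ _≤_ (*-comm c a) (*-comm c b) (*-monoʳ-≤ c≥0 p)

  *-nonneg : ∀ {a b} → 0# ≤ a → 0# ≤ b → 0# ≤ a * b
  *-nonneg {a} {b} a≥0 b≥0 = subst (_≤ a * b) (zeroʳ a) (*-monoʳ-≤ a≥0 b≥0)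

  *-mono-≤ : ∀ {a b c d} → 0# ≤ b → 0# ≤ c → a ≤ b → c ≤ d → a * c ≤ b * d
  *-mono-≤ b≥0 c≥0 p q = ≤-trans (*-monoˡ-≤ c≥0 p) (*-monoʳ-≤ b≥0 q)

  *-cancelˡ-< : ∀ {c x y} → 0# < c → c * x < c * y → x < y
  *-cancelˡ-< {c} {x} {y} c>0 p with compare x y
  ... | tri< x<y _ _ = x<y
  ... | tri≈ _ refl _ = ⊥-elim (<-irrefl p)
  ... | tri> _ _ y<x = ⊥-elim (<-irrefl (<-trans p (*-monoʳ-< c>0 y<x)))

  *-cancelˡ-≤ : ∀ {c x y} → 0# < c → c * x ≤ c * y → x ≤ y
  *-cancelˡ-≤ {c} {x} {y} c>0 p with compare x y
  ... | tri< x<y _ _ = inj₁ x<y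
  ... | tri≈ _ x≡y _ = inj₂ x≡y
  ... | tri> _ _ y<x = ⊥-elim (<-irrefl (≤-<-trans p (*-monoʳ-< c>0 y<x)))

  ∣∣-cases : ∀ x → (∣ x ∣ ≡ x × 0# ≤ x) ⊎ (∣ x ∣ ≡ - x × x < 0#)
  ∣∣-cases x with compare x 0#
  ... | tri< x<0 _ _ = inj₂ (refl , x<0)
  ... | tri≈ _ x≡0 _ = inj₁ (refl , inj₂ (sym x≡0))
  ... | tri> _ _ x>0 = inj₁ (refl , inj₁ x>0)

  ∣x∣≥0 : ∀ x → 0# ≤ ∣ x ∣
  ∣x∣≥0 x with ∣∣-cases x
  ... | inj₁ (eq , x≥0) = subst (0# ≤_) (sym eq) x≥0
  ... | inj₂ (eq , x<0) = subst (0# ≤_) (sym eq) (inj₁ (neg-neg x<0))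

  x≤∣x∣ : ∀ x → x ≤ ∣ x ∣
  x≤∣x∣ x with ∣∣-cases x
  ... | inj₁ (eq , _)   = inj₂ (sym eq)
  ... | inj₂ (eq , x<0) = subst (x ≤_) (sym eq) (inj₁ (<-trans x<0 (neg-neg x<0)))

  -x≤∣x∣ : ∀ x → - x ≤ ∣ x ∣
  -x≤∣x∣ x with ∣∣-cases x
  ... | inj₁ (eq , x≥0) = subst (- x ≤_) (sym eq) (≤-trans (neg-nonneg x≥0) x≥0)
  ... | inj₂ (eq , _)   = inj₂ (sym eq)

  ∣x∣≤ : ∀ {x c} → x ≤ c → - x ≤ c → ∣ x ∣ ≤ c
  ∣x∣≤ {x} p q with ∣∣-cases x
  ... | inj₁ (eq , _) = subst (_≤ _) (sym eq) p
  ... | inj₂ (eq , _) = subst (_≤ _) (sym eq) q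

  ∣x∣< : ∀ {x c} → x < c → - x < c → ∣ x ∣ < c
  ∣x∣< {x} p q with ∣∣-cases x
  ... | inj₁ (eq , _) = subst (_< _) (sym eq) p
  ... | inj₂ (eq , _) = subst (_< _) (sym eq) q

  ∣x∣≡x : ∀ {x} → 0# ≤ x → ∣ x ∣ ≡ x
  ∣x∣≡x {x} x≥0 with ∣∣-cases x
  ... | inj₁ (eq , _)   = eq
  ... | inj₂ (_ , x<0) = ⊥-elim (<-irrefl (≤-<-trans x≥0 x<0))

  ∣-x∣≤∣x∣ : ∀ x → ∣ - x ∣ ≤ ∣ x ∣
  ∣-x∣≤∣x∣ x = ∣x∣≤ (-x≤∣x∣ x) (subst (_≤ ∣ x ∣) (sym (-‿involutive x)) (x≤∣x∣ x))

  ∣x+y∣≤∣x∣+∣y∣ : ∀ x y → ∣ x + y ∣ ≤ ∣ x ∣ + ∣ y ∣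
  ∣x+y∣≤∣x∣+∣y∣ x y = ∣x∣≤ (+-mono-≤ (x≤∣x∣ x) (x≤∣x∣ y))
    (subst (_≤ ∣ x ∣ + ∣ y ∣) (-‿+-comm x y) (+-mono-≤ (-x≤∣x∣ x) (-x≤∣x∣ y)))

  telescope : ∀ x y z → (x − y) + (y − z) ≡ x − z
  telescope x y z = begin
    (x + - y) + (y + - z)  ≡⟨ +-assoc x (- y) (y + - z) ⟩
    x + (- y + (y + - z))  ≡⟨ cong (x +_) (+-assoc (- y) y (- z)) ⟨
    x + ((- y + y) + - z)  ≡⟨ cong (λ w → x + (w + - z)) (-‿inverseˡ y) ⟩
    x + (0# + - z)         ≡⟨ cong (x +_) (+-identityˡ (- z)) ⟩
    x + - z                ∎
    where open ≡-Reasoning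

  dist-triangle : ∀ x y z → ∣ x − z ∣ ≤ ∣ x − y ∣ + ∣ y − z ∣
  dist-triangle x y z = subst (λ w → ∣ w ∣ ≤ ∣ x − y ∣ + ∣ y − z ∣) (telescope x y z)
                              (∣x+y∣≤∣x∣+∣y∣ (x − y) (y − z))

  ∣x∣≤∣x−y∣+∣y∣ : ∀ x y → ∣ x ∣ ≤ ∣ x − y ∣ + ∣ y ∣
  ∣x∣≤∣x−y∣+∣y∣ x y = subst (λ w → ∣ w ∣ ≤ ∣ x − y ∣ + ∣ y ∣) restore (∣x+y∣≤∣x∣+∣y∣ (x − y) y)
    where
    restore : (x − y) + y ≡ x
    restore = trans (+-assoc x (- y) y) (trans (cong (x +_) (-‿inverseˡ y)) (+-identityʳ x))

  ∣z∣≤±z : ∀ {z w} → 0# ≤ w → w ≡ z ⊎ w ≡ - z → ∣ z ∣ ≤ w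
  ∣z∣≤±z w≥0 (inj₁ refl) = ∣x∣≤ (inj₂ refl) (≤-trans (neg-nonneg w≥0) w≥0)
  ∣z∣≤±z {z} w≥0 (inj₂ refl) =
    ∣x∣≤ (subst (_≤ - z) (-‿involutive z) (≤-trans (neg-nonneg w≥0) w≥0)) (inj₂ refl)

  ∣x*y∣≤∣x∣*∣y∣ : ∀ x y → ∣ x * y ∣ ≤ ∣ x ∣ * ∣ y ∣
  ∣x*y∣≤∣x∣*∣y∣ x y =
    ∣z∣≤±z (*-nonneg (∣x∣≥0 x) (∣x∣≥0 y)) (signs (∣∣-cases x) (∣∣-cases y))
    where
    open ≡-Reasoning
    signs : _ → _ → ∣ x ∣ * ∣ y ∣ ≡ x * y ⊎ ∣ x ∣ * ∣ y ∣ ≡ - (x * y)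
    signs (inj₁ (ex , _)) (inj₁ (ey , _)) = inj₁ (cong₂ _*_ ex ey)
    signs (inj₁ (ex , _)) (inj₂ (ey , _)) = inj₂ (trans (cong₂ _*_ ex ey) (sym (-‿distribʳ-* x y)))
    signs (inj₂ (ex , _)) (inj₁ (ey , _)) = inj₂ (trans (cong₂ _*_ ex ey) (sym (-‿distribˡ-* x y)))
    signs (inj₂ (ex , _)) (inj₂ (ey , _)) = inj₁ (begin
      ∣ x ∣ * ∣ y ∣  ≡⟨ cong₂ _*_ ex ey ⟩
      - x * - y      ≡⟨ -‿distribˡ-* x (- y) ⟨
      - (x * - y)    ≡⟨ cong -_ (-‿distribʳ-* x y) ⟨
      - (- (x * y))  ≡⟨ -‿involutive (x * y) ⟩
      x * y          ∎)

  fromℕ-+ : ∀ a b → fromℕ (a ℕ.+ b) ≡ fromℕ a + fromℕ b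
  fromℕ-+ zero    b = sym (+-identityˡ (fromℕ b))
  fromℕ-+ (suc a) b = trans (cong (1# +_) (fromℕ-+ a b)) (sym (+-assoc 1# (fromℕ a) (fromℕ b)))

  fromℕ-* : ∀ a b → fromℕ (a ℕ.* b) ≡ fromℕ a * fromℕ b
  fromℕ-* zero    b = sym (zeroˡ (fromℕ b))
  fromℕ-* (suc a) b = begin
    fromℕ (b ℕ.+ a ℕ.* b)             ≡⟨ fromℕ-+ b (a ℕ.* b) ⟩
    fromℕ b + fromℕ (a ℕ.* b)         ≡⟨ cong₂ _+_ (sym (*-identityˡ (fromℕ b))) (fromℕ-* a b) ⟩
    1# * fromℕ b + fromℕ a * fromℕ b  ≡⟨ distribʳ (fromℕ b) 1# (fromℕ a) ⟨
    (1# + fromℕ a) * fromℕ b          ∎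
    where open ≡-Reasoning

  fromℕ-1 : fromℕ 1 ≡ 1#
  fromℕ-1 = +-identityʳ 1#

  0<1+x : ∀ {x} → 0# ≤ x → 0# < 1# + x
  0<1+x x≥0 = <-≤-trans (subst (0# <_) (sym (+-identityʳ 1#)) 0<1) (+-monoʳ-≤ 1# x≥0)

  fromℕ-nonneg : ∀ n → 0# ≤ fromℕ n
  fromℕ-nonneg zero    = inj₂ refl
  fromℕ-nonneg (suc n) = inj₁ (0<1+x (fromℕ-nonneg n))

  fromℕ-pos : ∀ {n} → 1 ℕ.≤ n → 0# < fromℕ n
  fromℕ-pos {suc n} _ = 0<1+x (fromℕ-nonneg n)

  fromℕ-mono : ∀ {a b} → a ℕ.≤ b → fromℕ a ≤ fromℕ b
  fromℕ-mono {a} {b} a≤b = subst (λ c → fromℕ a ≤ fromℕ c) (ℕₚ.m+[n∸m]≡n a≤b)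
    (subst (fromℕ a ≤_) (sym (fromℕ-+ a (b ℕ.∸ a))) (x≤x+y (fromℕ-nonneg (b ℕ.∸ a))))

  scale-+ : ∀ a b y → fromℕ (a ℕ.+ b) * y ≡ fromℕ a * y + fromℕ b * y
  scale-+ a b y = trans (cong (_* y) (fromℕ-+ a b)) (distribʳ y (fromℕ a) (fromℕ b))

  scale-* : ∀ a b y → fromℕ a * (fromℕ b * y) ≡ fromℕ (a ℕ.* b) * y
  scale-* a b y = trans (sym (*-assoc (fromℕ a) (fromℕ b) y)) (cong (_* y) (sym (fromℕ-* a b)))

  scale-mono : ∀ {a b y} → 0# ≤ y → a ℕ.≤ b → fromℕ a * y ≤ fromℕ b * y
  scale-mono y≥0 a≤b = *-monoˡ-≤ y≥0 (fromℕ-mono a≤b)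

  >0⇒≢0 : ∀ {x} → 0# < x → x ≢ 0#
  >0⇒≢0 x>0 refl = <-irrefl x>0

  ⁻¹-pos : ∀ {x} → 0# < x → 0# < x ⁻¹
  ⁻¹-pos {x} x>0 with compare (x ⁻¹) 0#
  ... | tri> _ _ pos = pos
  ... | tri≈ _ x⁻¹≡0 _ = ⊥-elim (<-irrefl (subst (0# <_) 1≡0 0<1))
    where
    1≡0 : 1# ≡ 0#
    1≡0 = trans (sym (⁻¹-inverse x (>0⇒≢0 x>0))) (trans (cong (x *_) x⁻¹≡0) (zeroʳ x))
  ... | tri< x⁻¹<0 _ _ = ⊥-elim (<-irrefl (<-trans 0<1 1<0))
    where
    1<0 : 1# < 0#
    1<0 = subst₂ _<_ (⁻¹-inverse x (>0⇒≢0 x>0)) (zeroʳ x) (*-monoʳ-< x>0 x⁻¹<0)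

  ⁻¹≤1 : ∀ {x} → 1# ≤ x → x ⁻¹ ≤ 1#
  ⁻¹≤1 {x} x≥1 = subst₂ _≤_ (*-identityˡ (x ⁻¹)) (⁻¹-inverse x (>0⇒≢0 x>0))
                        (*-monoˡ-≤ (inj₁ (⁻¹-pos x>0)) x≥1)
    where
    x>0 : 0# < x
    x>0 = <-≤-trans 0<1 x≥1

  ∣fromℤ∣≤ : ∀ z → ∣ fromℤ z ∣ ≤ fromℕ ℤ.∣ z ∣
  ∣fromℤ∣≤ (ℤ.+ n)     = inj₂ (∣x∣≡x (fromℕ-nonneg n))
  ∣fromℤ∣≤ ℤ.-[1+ n ] = ≤-trans (∣-x∣≤∣x∣ (fromℕ (suc n))) (inj₂ (∣x∣≡x (fromℕ-nonneg (suc n))))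

  ∣⌊x⌋−x∣<1 : ∀ x → ∣ fromℤ ⌊ x ⌋ − x ∣ < 1#
  ∣⌊x⌋−x∣<1 x = ∣x∣< (≤-<-trans f−x≤0 0<1) (subst₂ _<_ (sym (⁻¹-anti-homo‿- f x)) (xyx⁻¹≈y f 1#)
                                                   (+-mono-< (- f) (⌊⌋-upper x)))
    where
    f : Carrier
    f = fromℤ ⌊ x ⌋
    f−x≤0 : f − x ≤ 0#
    f−x≤0 = subst (f − x ≤_) (-‿inverseʳ x) (+-monoˡ-≤ (- x) (⌊⌋-lower x))

  floor-scaled-error : ∀ {N} → 0# < N → ∀ v → ∣ (fromℤ ⌊ v * N ⌋ * N ⁻¹) − v ∣ < N ⁻¹
  floor-scaled-error {N} N>0 v = begin-strict
    ∣ (f * ε) − v ∣        ≡⟨ cong ∣_∣ rescale ⟨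
    ∣ (f − x) * ε ∣        ≤⟨ ∣x*y∣≤∣x∣*∣y∣ (f − x) ε ⟩
    ∣ f − x ∣ * ∣ ε ∣      ≡⟨ cong (∣ f − x ∣ *_) (∣x∣≡x (inj₁ ε>0)) ⟩
    ∣ f − x ∣ * ε          <⟨ *-monoˡ-< ε>0 (∣⌊x⌋−x∣<1 x) ⟩
    1# * ε                 ≡⟨ *-identityˡ ε ⟩
    ε                      ∎
    where
    open ≤-Reasoning
    ε x f : Carrier
    ε = N ⁻¹
    x = v * N
    f = fromℤ ⌊ x ⌋
    ε>0 : 0# < ε
    ε>0 = ⁻¹-pos N>0
    x*ε≡v : x * ε ≡ v
    x*ε≡v = trans (*-assoc v N ε) (trans (cong (v *_) (⁻¹-inverse N (>0⇒≢0 N>0))) (*-identityʳ v))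
    rescale : (f − x) * ε ≡ (f * ε) − v
    rescale = trans ([y-z]x≈yx-zx ε f x) (cong (λ w → (f * ε) − w) x*ε≡v)

  ulp : ℕ → Carrier
  ulp m = fromℕ (2 ℕ.^ m) ⁻¹

  2^m>0 : ∀ m → 0# < fromℕ (2 ℕ.^ m)
  2^m>0 m = fromℕ-pos (ℕₚ.m^n>0 2 m)

  ulp>0 : ∀ m → 0# < ulp m
  ulp>0 m = ⁻¹-pos (2^m>0 m)

  scale-ulp≤1 : ∀ {a} m → a ℕ.≤ 2 ℕ.^ m → fromℕ a * ulp m ≤ 1#
  scale-ulp≤1 m a≤2^m = ≤-trans (scale-mono (inj₁ (ulp>0 m)) a≤2^m)
                                (inj₂ (⁻¹-inverse _ (>0⇒≢0 (2^m>0 m))))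

  T-error : ∀ m u → ∣ T m u − u ∣ < ulp m
  T-error m u with compare u 0#
  ... | tri> _ _ _    = floor-scaled-error (2^m>0 m) u
  ... | tri≈ _ refl _ = subst (λ w → ∣ w ∣ < ulp m) (sym (-‿inverseʳ 0#))
                          (subst (_< ulp m) (sym (∣x∣≡x (inj₂ refl))) (ulp>0 m))
  ... | tri< _ _ _    = ≤-<-trans (subst (λ w → ∣ w ∣ ≤ ∣ A − (- u) ∣) negate (∣-x∣≤∣x∣ (A − (- u))))
                                  (floor-scaled-error (2^m>0 m) (- u))
    where
    A : Carrier
    A = fromℤ ⌊ (- u) * fromℕ (2 ℕ.^ m) ⌋ * ulp m
    negate : - (A − (- u)) ≡ (- A) − u
    negate = trans (sym (-‿+-comm A (- (- u)))) (cong (- A +_) (-‿involutive (- u)))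

  ^ᶠ-nonneg : ∀ {g} n → 0# ≤ g → 0# ≤ g ^ᶠ n
  ^ᶠ-nonneg zero    _   = inj₁ 0<1
  ^ᶠ-nonneg (suc n) g≥0 = *-nonneg g≥0 (^ᶠ-nonneg n g≥0)

  ∣x^n∣≤∣x∣^n : ∀ x n → ∣ x ^ᶠ n ∣ ≤ ∣ x ∣ ^ᶠ n
  ∣x^n∣≤∣x∣^n x zero    = inj₂ (∣x∣≡x (inj₁ 0<1))
  ∣x^n∣≤∣x∣^n x (suc n) = ≤-trans (∣x*y∣≤∣x∣*∣y∣ x (x ^ᶠ n)) (*-monoʳ-≤ (∣x∣≥0 x) (∣x^n∣≤∣x∣^n x n))

  ^ᶠ≤1 : ∀ {g} n → 0# ≤ g → g ≤ 1# → g ^ᶠ n ≤ 1#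
  ^ᶠ≤1 zero    _   _   = inj₂ refl
  ^ᶠ≤1 {g} (suc n) g≥0 g≤1 = subst (g * g ^ᶠ n ≤_) (*-identityˡ 1#)
                                    (*-mono-≤ (inj₁ 0<1) (^ᶠ-nonneg n g≥0) g≤1 (^ᶠ≤1 n g≥0 g≤1))

  ^ᶠ≤base : ∀ {g} n → 1 ℕ.≤ n → 0# ≤ g → g ≤ 1# → g ^ᶠ n ≤ g
  ^ᶠ≤base {g} (suc n) _ g≥0 g≤1 = subst (g * g ^ᶠ n ≤_) (*-identityʳ g) (*-monoʳ-≤ g≥0 (^ᶠ≤1 n g≥0 g≤1))

  -- The invariant 2|Σ_{j<n} f j| + 3 g^n ≤ 3 is preserved because
  -- the new term 2|f n| ≤ 2 g^n is paid for by 3 g^n - 3 g^(n+1) ≥ g^n.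
  module _ {g : Carrier} (g≥0 : 0# ≤ g) (3g≤1 : fromℕ 3 * g ≤ 1#)
           (f : ℕ → Carrier) (f-bound : ∀ j → ∣ f j ∣ ≤ g ^ᶠ j) where

    geometric-invariant : ∀ n → fromℕ 2 * ∣ sumTo n f ∣ + fromℕ 3 * g ^ᶠ n ≤ fromℕ 3
    geometric-invariant zero = inj₂ (begin
      fromℕ 2 * ∣ 0# ∣ + fromℕ 3 * 1#
        ≡⟨ cong₂ _+_ (cong (fromℕ 2 *_) (∣x∣≡x (inj₂ refl))) (*-identityʳ (fromℕ 3)) ⟩
      fromℕ 2 * 0# + fromℕ 3           ≡⟨ cong (_+ fromℕ 3) (zeroʳ (fromℕ 2)) ⟩
      0# + fromℕ 3                     ≡⟨ +-identityˡ (fromℕ 3) ⟩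
      fromℕ 3                          ∎)
      where open ≡-Reasoning
    geometric-invariant (suc n) = begin
      fromℕ 2 * ∣ S + f n ∣ + fromℕ 3 * (g * y)
        ≤⟨ +-monoˡ-≤ _ (*-monoʳ-≤ (fromℕ-nonneg 2) (∣x+y∣≤∣x∣+∣y∣ S (f n))) ⟩
      fromℕ 2 * (∣ S ∣ + ∣ f n ∣) + fromℕ 3 * (g * y)
        ≡⟨ regroup ⟩
      fromℕ 2 * ∣ S ∣ + (fromℕ 2 * ∣ f n ∣ + (fromℕ 3 * g) * y)
        ≤⟨ +-monoʳ-≤ _ (+-mono-≤ (*-monoʳ-≤ (fromℕ-nonneg 2) (f-bound n)) (*-monoˡ-≤ y≥0 3g≤1)) ⟩
      fromℕ 2 * ∣ S ∣ + (fromℕ 2 * y + 1# * y)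
        ≡⟨ cong (fromℕ 2 * ∣ S ∣ +_) two-plus-one ⟩
      fromℕ 2 * ∣ S ∣ + fromℕ 3 * y
        ≤⟨ geometric-invariant n ⟩
      fromℕ 3 ∎
      where
      open ≤-Reasoning
      S y : Carrier
      S = sumTo n f
      y = g ^ᶠ n
      y≥0 : 0# ≤ y
      y≥0 = ^ᶠ-nonneg n g≥0
      regroup : fromℕ 2 * (∣ S ∣ + ∣ f n ∣) + fromℕ 3 * (g * y)
              ≡ fromℕ 2 * ∣ S ∣ + (fromℕ 2 * ∣ f n ∣ + (fromℕ 3 * g) * y)
      regroup = trans (cong₂ _+_ (distribˡ (fromℕ 2) ∣ S ∣ ∣ f n ∣) (sym (*-assoc (fromℕ 3) g y)))
                      (+-assoc (fromℕ 2 * ∣ S ∣) (fromℕ 2 * ∣ f n ∣) ((fromℕ 3 * g) * y))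
      two-plus-one : fromℕ 2 * y + 1# * y ≡ fromℕ 3 * y
      two-plus-one = trans (cong (λ c → fromℕ 2 * y + c * y) (sym fromℕ-1)) (sym (scale-+ 2 1 y))

    geometric-bound : ∀ n → fromℕ 2 * ∣ sumTo n f ∣ ≤ fromℕ 3
    geometric-bound n = ≤-trans (x≤x+y (*-nonneg (fromℕ-nonneg 3) (^ᶠ-nonneg n g≥0))) (geometric-invariant n)

  perturbation : ∀ s s* t t* h H →
    (s* + t* * h) − (s + t * H) ≡ (s* − s) + (t* * (h − H) + (t* − t) * H)
  perturbation s s* t t* h H = begin
    (s* + t* * h) + - (s + t * H)       ≡⟨ cong ((s* + t* * h) +_) (-‿+-comm s (t * H)) ⟨
    (s* + t* * h) + (- s + - (t * H))   ≡⟨ interchange s* (t* * h) (- s) (- (t * H)) ⟩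
    (s* − s) + ((t* * h) − (t * H))     ≡⟨ cong ((s* − s) +_) (telescope (t* * h) (t* * H) (t * H)) ⟨
    (s* − s) + (((t* * h) − (t* * H)) + ((t* * H) − (t * H)))
      ≡⟨ cong ((s* − s) +_) (cong₂ _+_ (x[y-z]≈xy-xz t* h H) ([y-z]x≈yx-zx H t* t)) ⟨
    (s* − s) + (t* * (h − H) + (t* − t) * H) ∎
    where open ≡-Reasoning

  step-error : ∀ m s s* t t* h H →
    ∣ T m (s* + t* * h) − (s + t * H) ∣ < ulp m + (∣ s* − s ∣ + (∣ t* ∣ * ∣ h − H ∣ + ∣ t* − t ∣ * ∣ H ∣))
  step-error m s s* t t* h H = begin-strict
    ∣ T m u − v ∣              ≤⟨ dist-triangle (T m u) u v ⟩
    ∣ T m u − u ∣ + ∣ u − v ∣  <⟨ +-mono-<-≤ (T-error m u) data-error ⟩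
    ulp m + (∣ s* − s ∣ + (∣ t* ∣ * ∣ h − H ∣ + ∣ t* − t ∣ * ∣ H ∣)) ∎
    where
    open ≤-Reasoning
    u v : Carrier
    u = s* + t* * h
    v = s + t * H
    data-error : ∣ u − v ∣ ≤ ∣ s* − s ∣ + (∣ t* ∣ * ∣ h − H ∣ + ∣ t* − t ∣ * ∣ H ∣)
    data-error = begin
      ∣ u − v ∣                                          ≡⟨ cong ∣_∣ (perturbation s s* t t* h H) ⟩
      ∣ (s* − s) + (t* * (h − H) + (t* − t) * H) ∣       ≤⟨ ∣x+y∣≤∣x∣+∣y∣ (s* − s) _ ⟩
      ∣ s* − s ∣ + ∣ t* * (h − H) + (t* − t) * H ∣       ≤⟨ +-monoʳ-≤ _ (∣x+y∣≤∣x∣+∣y∣ _ _) ⟩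
      ∣ s* − s ∣ + (∣ t* * (h − H) ∣ + ∣ (t* − t) * H ∣) ≤⟨ +-monoʳ-≤ _ (+-mono-≤ (∣x*y∣≤∣x∣*∣y∣ t* (h − H))
                                                                                (∣x*y∣≤∣x∣*∣y∣ (t* − t) H)) ⟩
      ∣ s* − s ∣ + (∣ t* ∣ * ∣ h − H ∣ + ∣ t* − t ∣ * ∣ H ∣) ∎

  step-error-in-ulps : ∀ m {s s* t t* h H} (P K Q : ℕ) →
    ∣ s* − s ∣ ≤ ulp m → ∣ t* − t ∣ ≤ ulp m → fromℕ 2 * ∣ t* ∣ ≤ 1# →
    ∣ h − H ∣ ≤ fromℕ P * ulp m → fromℕ 2 * ∣ H ∣ ≤ fromℕ K →
    2 ℕ.+ (2 ℕ.+ (P ℕ.+ K)) ℕ.≤ 2 ℕ.* Q →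
    ∣ T m (s* + t* * h) − (s + t * H) ∣ < fromℕ Q * ulp m
  step-error-in-ulps m {s} {s*} {t} {t*} {h} {H} P K Q s-close t-close t*-small h-close H-small budget =
    *-cancelˡ-< two>0 (begin-strict
      two * ∣ T m (s* + t* * h) − (s + t * H) ∣
        <⟨ *-monoʳ-< two>0 (step-error m s s* t t* h H) ⟩
      two * (ε + (a + (c * e + b * d)))
        ≡⟨ expand ⟩
      two * ε + (two * a + ((two * c) * e + b * (two * d)))
        ≤⟨ +-monoʳ-≤ _ (+-mono-≤ (*-monoʳ-≤ two≥0 s-close)
                                 (+-mono-≤ (*-mono-≤ (inj₁ 0<1) (∣x∣≥0 _) t*-small h-close)
                                           (*-mono-≤ ε≥0 (*-nonneg two≥0 (∣x∣≥0 H)) t-close H-small))) ⟩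
      two * ε + (two * ε + (1# * (fromℕ P * ε) + ε * fromℕ K))
        ≡⟨ collect ⟩
      fromℕ (2 ℕ.+ (2 ℕ.+ (P ℕ.+ K))) * ε
        ≤⟨ scale-mono ε≥0 budget ⟩
      fromℕ (2 ℕ.* Q) * ε
        ≡⟨ scale-* 2 Q ε ⟨
      two * (fromℕ Q * ε) ∎)
    where
    open ≤-Reasoning
    two ε a b c d e : Carrier
    two = fromℕ 2
    ε = ulp m
    a = ∣ s* − s ∣
    b = ∣ t* − t ∣
    c = ∣ t* ∣
    d = ∣ H ∣
    e = ∣ h − H ∣
    two>0 : 0# < two
    two>0 = fromℕ-pos {2} (ℕ.s≤s ℕ.z≤n)
    two≥0 : 0# ≤ two
    two≥0 = inj₁ two>0
    ε≥0 : 0# ≤ ε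
    ε≥0 = inj₁ (ulp>0 m)
    expand : two * (ε + (a + (c * e + b * d)))
           ≡ two * ε + (two * a + ((two * c) * e + b * (two * d)))
    expand = trans (distribˡ two ε _) (cong (two * ε +_)
             (trans (distribˡ two a _) (cong (two * a +_)
             (trans (distribˡ two (c * e) (b * d))
                    (cong₂ _+_ (sym (*-assoc two c e)) (x∙yz≈y∙xz two b d))))))
    collect : two * ε + (two * ε + (1# * (fromℕ P * ε) + ε * fromℕ K))
            ≡ fromℕ (2 ℕ.+ (2 ℕ.+ (P ℕ.+ K))) * ε
    collect = begin-equality
      two * ε + (two * ε + (1# * (fromℕ P * ε) + ε * fromℕ K))
        ≡⟨ cong (λ w → two * ε + (two * ε + w)) (cong₂ _+_ (*-identityˡ _) (*-comm ε (fromℕ K))) ⟩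
      two * ε + (two * ε + (fromℕ P * ε + fromℕ K * ε))
        ≡⟨ cong (λ w → two * ε + (two * ε + w)) (scale-+ P K ε) ⟨
      two * ε + (two * ε + fromℕ (P ℕ.+ K) * ε)
        ≡⟨ cong (two * ε +_) (scale-+ 2 (P ℕ.+ K) ε) ⟨
      two * ε + fromℕ (2 ℕ.+ (P ℕ.+ K)) * ε
        ≡⟨ scale-+ 2 (2 ℕ.+ (P ℕ.+ K)) ε ⟨
      fromℕ (2 ℕ.+ (2 ℕ.+ (P ℕ.+ K))) * ε ∎


module Analysis (R : RealField) (k ν : ℕ) (β : ℤ) where
  open RealField R
  open Setup R k ν β
  open OrderedField R
  open IsCommutativeRing isCommutativeRing using (+-identityʳ; *-identityˡ; *-identityʳ; *-comm; distribˡ)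

  γ-small : 2 ℕ.≤ ν → ℤ.∣ β ∣ ℕ.< 2 ^ (2 ^ (ν ∸ 1)) → fromℕ 4 * ∣ γ ∣ ≤ 1#
  γ-small 2≤ν β-small = begin
    fromℕ 4 * ∣ fromℤ β * ε ∣            ≤⟨ *-monoʳ-≤ (fromℕ-nonneg 4) (∣x*y∣≤∣x∣*∣y∣ (fromℤ β) ε) ⟩
    fromℕ 4 * (∣ fromℤ β ∣ * ∣ ε ∣)      ≡⟨ cong (λ w → fromℕ 4 * (∣ fromℤ β ∣ * w)) (∣x∣≡x ε≥0) ⟩
    fromℕ 4 * (∣ fromℤ β ∣ * ε)          ≤⟨ *-monoʳ-≤ (fromℕ-nonneg 4) (*-monoˡ-≤ ε≥0 (∣fromℤ∣≤ β)) ⟩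
    fromℕ 4 * (fromℕ ℤ.∣ β ∣ * ε)        ≡⟨ scale-* 4 ℤ.∣ β ∣ ε ⟩
    fromℕ (4 ℕ.* ℤ.∣ β ∣) * ε            ≤⟨ scale-ulp≤1 (2 ^ ν) (4b≤2^2^ν ν ℤ.∣ β ∣ 2≤ν β-small) ⟩
    1#                                   ∎
    where
    open ≤-Reasoning
    ε : Carrier
    ε = ulp (2 ^ ν)
    ε≥0 : 0# ≤ ε
    ε≥0 = inj₁ (ulp>0 (2 ^ ν))

  term-bound : ∀ a j → ∣ γ ^ᶠ j * fromℕ (prodFrom a j) ⁻¹ ∣ ≤ ∣ γ ∣ ^ᶠ j
  term-bound a j = begin
    ∣ γ ^ᶠ j * p⁻¹ ∣          ≤⟨ ∣x*y∣≤∣x∣*∣y∣ (γ ^ᶠ j) p⁻¹ ⟩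
    ∣ γ ^ᶠ j ∣ * ∣ p⁻¹ ∣      ≡⟨ cong (∣ γ ^ᶠ j ∣ *_) (∣x∣≡x (inj₁ p⁻¹>0)) ⟩
    ∣ γ ^ᶠ j ∣ * p⁻¹          ≤⟨ *-mono-≤ (^ᶠ-nonneg j (∣x∣≥0 γ)) (inj₁ p⁻¹>0) (∣x^n∣≤∣x∣^n γ j) (⁻¹≤1 p≥1) ⟩
    ∣ γ ∣ ^ᶠ j * 1#           ≡⟨ *-identityʳ (∣ γ ∣ ^ᶠ j) ⟩
    ∣ γ ∣ ^ᶠ j                ∎
    where
    open ≤-Reasoning
    p≥1 : 1# ≤ fromℕ (prodFrom a j)
    p≥1 = subst (_≤ fromℕ (prodFrom a j)) fromℕ-1 (fromℕ-mono (prodFrom≥1 a j))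
    p⁻¹ : Carrier
    p⁻¹ = fromℕ (prodFrom a j) ⁻¹
    p⁻¹>0 : 0# < p⁻¹
    p⁻¹>0 = ⁻¹-pos (<-≤-trans 0<1 p≥1)

  module Bounds (4∣γ∣≤1 : fromℕ 4 * ∣ γ ∣ ≤ 1#) (k₁≥2 : 2 ℕ.≤ k₁) where

    c∣γ∣≤1 : ∀ {c} → c ℕ.≤ 4 → fromℕ c * ∣ γ ∣ ≤ 1#
    c∣γ∣≤1 c≤4 = ≤-trans (scale-mono (∣x∣≥0 γ) c≤4) 4∣γ∣≤1

    ∣γ∣≤1 : ∣ γ ∣ ≤ 1#
    ∣γ∣≤1 = subst (_≤ 1#) (trans (cong (_* ∣ γ ∣) fromℕ-1) (*-identityˡ ∣ γ ∣)) (c∣γ∣≤1 {1} (ℕ.s≤s ℕ.z≤n))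

    r₁≥1 : 1 ℕ.≤ r₁
    r₁≥1 = ⌈/⌉-pos r k₁ (ℕₚ.m^n>0 2 k₁) (ℕₚ.≤-trans (ℕ.s≤s ℕ.z≤n) k₁≥2)

    -- 2|σ_t| ≤ 3: σ_t is a sum whose j-th term is bounded by |γ|^j, 3|γ| ≤ 1.
    σ-bound : ∀ t → fromℕ 2 * ∣ σ t ∣ ≤ fromℕ 3
    σ-bound t = geometric-bound (∣x∣≥0 γ) (c∣γ∣≤1 {3} (ℕₚ.n≤1+n 3)) _ (term-bound ((t ∸ 1) ℕ.* r₁)) r₁

    -- 4|τ_t| ≤ 1, since |τ_t| ≤ |γ|^{r₁} ≤ |γ| as r₁ ≥ 1.
    τ-bound : ∀ t → fromℕ 4 * ∣ τ t ∣ ≤ 1#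
    τ-bound t = ≤-trans (*-monoʳ-≤ (fromℕ-nonneg 4)
                          (≤-trans (term-bound ((t ∸ 2) ℕ.* r₁) r₁) (^ᶠ≤base r₁ r₁≥1 (∣x∣≥0 γ) ∣γ∣≤1)))
                        4∣γ∣≤1

    -- 2|H_i| ≤ 4 for every i ≥ 1, along the recurrence H_i = σ + τ H_{i-1}:
    -- 2|σ + τ H| ≤ 2|σ| + |τ|·2|H| ≤ 3 + 4|τ| ≤ 4.
    H-bound : ∀ n → fromℕ 2 * ∣ H (suc n) ∣ ≤ fromℕ 4
    H-bound zero    = ≤-trans (σ-bound k₁) (fromℕ-mono (ℕₚ.n≤1+n 3))
    H-bound (suc n) = begin
      two * ∣ s + t * Hₙ ∣
        ≤⟨ *-monoʳ-≤ (fromℕ-nonneg 2)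
             (≤-trans (∣x+y∣≤∣x∣+∣y∣ s (t * Hₙ)) (+-monoʳ-≤ _ (∣x*y∣≤∣x∣*∣y∣ t Hₙ))) ⟩
      two * (∣ s ∣ + ∣ t ∣ * ∣ Hₙ ∣)
        ≡⟨ trans (distribˡ two ∣ s ∣ _) (cong (two * ∣ s ∣ +_) (x∙yz≈y∙xz two ∣ t ∣ ∣ Hₙ ∣)) ⟩
      two * ∣ s ∣ + ∣ t ∣ * (two * ∣ Hₙ ∣)
        ≤⟨ +-mono-≤ (σ-bound (k₁ ∸ suc n)) (*-monoʳ-≤ (∣x∣≥0 t) (H-bound n)) ⟩
      fromℕ 3 + ∣ t ∣ * fromℕ 4
        ≡⟨ cong (fromℕ 3 +_) (*-comm ∣ t ∣ (fromℕ 4)) ⟩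
      fromℕ 3 + fromℕ 4 * ∣ t ∣
        ≤⟨ +-monoʳ-≤ (fromℕ 3) (τ-bound (k₁ ∸ n)) ⟩
      fromℕ 3 + 1#
        ≡⟨ trans (cong (fromℕ 3 +_) (sym fromℕ-1)) (sym (fromℕ-+ 3 1)) ⟩
      fromℕ 4 ∎
      where
      open ≤-Reasoning
      two s t Hₙ : Carrier
      two = fromℕ 2
      s = σ (k₁ ∸ suc n)
      t = τ (k₁ ∸ n)
      Hₙ = H (suc n)

    module Propagation (m₁ : ℕ) (σ* τ* : ℕ → Carrier) (m₁≥2 : 2 ℕ.≤ m₁)
      (σ*-accurate : ∀ t → 1 ℕ.≤ t → t ℕ.≤ k₁ → ∣ σ* t − σ t ∣ ≤ ulp m₁)
      (τ*-accurate : ∀ t → 2 ℕ.≤ t → t ℕ.≤ k₁ → ∣ τ* t − τ t ∣ ≤ ulp m₁) where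

      -- 2|τ*_t| ≤ 1, because 4|τ*_t| ≤ 4|τ*_t - τ_t| + 4|τ_t| ≤ 4·2^-m₁ + 1 ≤ 2.
      τ*-small : ∀ t → 2 ℕ.≤ t → t ℕ.≤ k₁ → fromℕ 2 * ∣ τ* t ∣ ≤ 1#
      τ*-small t 2≤t t≤k₁ = *-cancelˡ-≤ (fromℕ-pos {2} (ℕ.s≤s ℕ.z≤n)) (begin
        fromℕ 2 * (fromℕ 2 * ∣ τ* t ∣)            ≡⟨ scale-* 2 2 ∣ τ* t ∣ ⟩
        fromℕ 4 * ∣ τ* t ∣                        ≤⟨ *-monoʳ-≤ (fromℕ-nonneg 4) (∣x∣≤∣x−y∣+∣y∣ (τ* t) (τ t)) ⟩
        fromℕ 4 * (∣ τ* t − τ t ∣ + ∣ τ t ∣)      ≡⟨ distribˡ (fromℕ 4) _ _ ⟩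
        fromℕ 4 * ∣ τ* t − τ t ∣ + fromℕ 4 * ∣ τ t ∣
          ≤⟨ +-mono-≤ (≤-trans (*-monoʳ-≤ (fromℕ-nonneg 4) (τ*-accurate t 2≤t t≤k₁))
                               (scale-ulp≤1 m₁ (ℕₚ.^-monoʳ-≤ 2 m₁≥2)))
                      (τ-bound t) ⟩
        1# + 1#                                   ≡⟨ cong (1# +_) (+-identityʳ 1#) ⟨
        fromℕ 2                                   ≡⟨ *-identityʳ (fromℕ 2) ⟨
        fromℕ 2 * 1#                              ∎)
        where open ≤-Reasoning

      -- Step i = n + 2 of the recurrence reads σ*_{k₁-n-1} and τ*_{k₁-n};
      -- both indices lie in the ranges covered by the hypotheses.
      σ*-at-step : ∀ n → 2 ℕ.+ n ℕ.≤ k₁ → ∣ σ* (k₁ ∸ suc n) − σ (k₁ ∸ suc n) ∣ ≤ ulp m₁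
      σ*-at-step n i≤k₁ = σ*-accurate _ (ℕₚ.m+n≤o⇒m≤o∸n 1 i≤k₁) (ℕₚ.m∸n≤m k₁ (suc n))

      τ*-at-step : ∀ n → 2 ℕ.+ n ℕ.≤ k₁ → ∣ τ* (k₁ ∸ n) − τ (k₁ ∸ n) ∣ ≤ ulp m₁
      τ*-at-step n i≤k₁ = τ*-accurate _ (ℕₚ.m+n≤o⇒m≤o∸n 2 i≤k₁) (ℕₚ.m∸n≤m k₁ n)

      τ*-small-at-step : ∀ n → 2 ℕ.+ n ℕ.≤ k₁ → fromℕ 2 * ∣ τ* (k₁ ∸ n) ∣ ≤ 1#
      τ*-small-at-step n i≤k₁ = τ*-small _ (ℕₚ.m+n≤o⇒m≤o∸n 2 i≤k₁) (ℕₚ.m∸n≤m k₁ n)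

      -- The error after i ≥ 2 steps is below 2^i · 2^-m₁.  The first step
      -- starts from |h₁ - H₁| ≤ 2^-m₁ with 2|H₁| ≤ 3; later steps start
      -- from the previous bound with 2|H| ≤ 4.
      error-bound : ∀ n → 2 ℕ.+ n ℕ.≤ k₁ →
        ∣ h m₁ σ* τ* (2 ℕ.+ n) − H (2 ℕ.+ n) ∣ < fromℕ (2 ^ (2 ℕ.+ n)) * ulp m₁
      error-bound zero i≤k₁ =
        step-error-in-ulps m₁ 1 3 4 (σ*-at-step 0 i≤k₁) (τ*-at-step 0 i≤k₁) (τ*-small-at-step 0 i≤k₁)
          first-error (σ-bound k₁) ℕₚ.≤-refl
        where
        first-error : ∣ σ* k₁ − σ k₁ ∣ ≤ fromℕ 1 * ulp m₁
        first-error = subst (∣ σ* k₁ − σ k₁ ∣ ≤_)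
                            (trans (sym (*-identityˡ _)) (cong (_* ulp m₁) (sym fromℕ-1)))
                            (σ*-accurate k₁ (ℕₚ.≤-trans (ℕ.s≤s ℕ.z≤n) k₁≥2) ℕₚ.≤-refl)
      error-bound (suc n) i≤k₁ =
        step-error-in-ulps m₁ (2 ^ (2 ℕ.+ n)) 4 (2 ^ (3 ℕ.+ n))
          (σ*-at-step (suc n) i≤k₁) (τ*-at-step (suc n) i≤k₁) (τ*-small-at-step (suc n) i≤k₁)
          (inj₁ (error-bound n (ℕₚ.≤-trans (ℕₚ.n≤1+n _) i≤k₁))) (H-bound (suc n)) (step-budget n)

      final-error : ∣ h m₁ σ* τ* k₁ − H k₁ ∣ < fromℕ (2 ^ k₁) * ulp m₁
      final-error = subst (λ i → ∣ h m₁ σ* τ* i − H i ∣ < fromℕ (2 ^ i) * ulp m₁) 2+[k₁∸2]≡k₁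
                          (error-bound (k₁ ∸ 2) (ℕₚ.≤-reflexive 2+[k₁∸2]≡k₁))
        where
        2+[k₁∸2]≡k₁ : 2 ℕ.+ (k₁ ∸ 2) ≡ k₁
        2+[k₁∸2]≡k₁ = ℕₚ.m+[n∸m]≡n k₁≥2

-- The statement uses the ℕ operations; they are opened only here because
-- they share their names with the field operations used above.
open import Data.Nat using (ℕ; _≤_; _<_; _+_; _^_; _∸_)
open import Data.Integer using (ℤ; ∣_∣)
open import Relation.Binary.PropositionalEquality using (_≡_)

lemma4 : (R : RealField) (k ν : ℕ) (β : ℤ) (m₁ : ℕ)
         (σ* τ* : ℕ → RealField.Carrier R) →
         4 ≤ k → 2 ≤ ν → ν ≤ k + 1 →
         ∣ β ∣ < 2 ^ (2 ^ (ν ∸ 1)) →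
         Setup.m R k ν β ≤ m₁ →
         (∀ t → 1 ≤ t → t ≤ Setup.k₁ R k ν β →
           RealField._≤_ R (RealField.∣_∣ R (RealField._−_ R (σ* t) (Setup.σ R k ν β t)))
                           (RealField._⁻¹ R (RealField.fromℕ R (2 ^ m₁)))) →
         (∀ t → 2 ≤ t → t ≤ Setup.k₁ R k ν β →
           RealField._≤_ R (RealField.∣_∣ R (RealField._−_ R (τ* t) (Setup.τ R k ν β t)))
                           (RealField._⁻¹ R (RealField.fromℕ R (2 ^ m₁)))) →
         RealField._<_ R
           (RealField.∣_∣ R (RealField._−_ R (Setup.h R k ν β m₁ σ* τ* (Setup.k₁ R k ν β))
                                             (Setup.H R k ν β (Setup.k₁ R k ν β))))
           (RealField._*_ R (RealField.fromℕ R (2 ^ Setup.k₁ R k ν β))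
                            (RealField._⁻¹ R (RealField.fromℕ R (2 ^ m₁))))
-- |γ| ≤ 1/4, k₁ ≥ 2 and m₁ ≥ 2 follow from the hypotheses on ν, β and m₁.
lemma4 R k ν β m₁ σ* τ* _ 2≤ν ν≤k+1 β-small m≤m₁ σ*-accurate τ*-accurate = final-error
  where
  open Analysis R k ν β
  open Bounds (γ-small 2≤ν β-small) (k+3∸ν≥2 k ν ν≤k+1)
  open Propagation m₁ σ* τ* (2≤m₁ k m₁ m≤m₁) σ*-accurate τ*-accurate
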